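{- Let $r\in\mathbb{N}$ and let $T$ be an $r$-ribbon tableau. If the column word of $T$ is latticed then the row-number tableau of $T$ is latticed.
   Context: A border strip is a connected skew shape with no $2\times2$ square; an $r$-border strip has $r$ boxes; its row number is the least index of a row it meets. A skew partition is a horizontal $r$-ribbon strip of size $rq$ if there is a chain $\sigma^{(0)}\subset\cdots\subset\sigma^{(q)}$ from its inner to its outer shape with each $\sigma^{(j)}/\sigma^{(j-1)}$ an $r$-border strip and row numbers weakly decreasing in $j$; this decomposition into $r$-border strips is then unique. An $r$-ribbon tableau of shape $\nu/\tau$ and weight $\alpha=(\alpha_1,\ldots,\alpha_\ell)$ is a chain $\tau=\rho^{(0)}\subset\cdots\subset\rho^{(\ell)}=\nu$ with each $\rho^{(j)}/\rho^{(j-1)}$ a horizontal $r$-ribbon strip of size $r\alpha_j$, with label $j$. Column word: fill each box of $\nu/\tau$ with the label of the ribbon strip containing it; read the columns from bottom to top, starting at the leftmost column, recording the label of each $r$-border strip (from the unique decompositions) when it is first seen, i.e. in its leftmost column. Row-number tableau: the row-standard tableau (rows weakly increasing, possibly empty rows) with an entry $i$ in row $a$ for each $r$-border strip of row number $a$ in the ribbon strip labelled $i$; its word is read along rows left to right starting with the highest-numbered row. A word is latticed if for every $k\ge1$ every suffix has at least as many $k$'s as $(k+1)$'s; a tableau is latticed if its word is. -}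

module Defs where

open import Data.Nat using (ℕ; zero; suc; _+_; _∸_; _≤_; _<_; _<ᵇ_; _≡ᵇ_)
open import Data.Bool using (Bool; true; false; if_then_else_; _∧_; not)
open import Data.List using (List; []; _∷_; _++_; length; upTo; reverse; concatMap; map; drop; filterᵇ; concat)
open import Data.Nat.ListAction using (sum)
open import Data.Bool.ListAction using (any)
open import Data.List.Relation.Unary.All using (All)
open import Data.List.Relation.Unary.Linked using (Linked)
open import Data.Product using (Σ; _×_; _,_; proj₁; proj₂)
open import Data.Sum using (_⊎_)
open import Relation.Binary.PropositionalEquality using (_≡_)
open import Relation.Nullary using (¬_)

-- A partition is a list of row lengths (rows indexed 0,1,2,... from the
-- top, English convention); trailing zeros are allowed.  A box is a pair
-- (row , column), both 0-indexed.

Partition : Set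
Partition = List ℕ

_!_ : Partition → ℕ → ℕ
[] ! _ = 0
(x ∷ xs) ! zero = x
(x ∷ xs) ! suc i = xs ! i

IsPartition : Partition → Set
IsPartition λ′ = ∀ i → λ′ ! suc i ≤ λ′ ! i

_⊆ₚ_ : Partition → Partition → Set
λ′ ⊆ₚ μ = ∀ i → λ′ ! i ≤ μ ! i

Box : Set
Box = ℕ × ℕ

InSkew : Partition → Partition → Box → Set
InSkew λ′ μ (a , c) = (λ′ ! a ≤ c) × (c < μ ! a)

inSkewᵇ : Partition → Partition → Box → Bool
inSkewᵇ λ′ μ (a , c) = not (c <ᵇ (λ′ ! a)) ∧ (c <ᵇ (μ ! a))

-- number of boxes of μ / λ (for λ ⊆ μ)
skewSize : Partition → Partition → ℕ
skewSize λ′ μ = sum μ ∸ sum λ′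

Adjacent : Box → Box → Set
Adjacent (a , c) (a′ , c′) =
  (a ≡ a′ × (suc c ≡ c′ ⊎ suc c′ ≡ c)) ⊎ (c ≡ c′ × (suc a ≡ a′ ⊎ suc a′ ≡ a))

data Path (S : Box → Set) : Box → Box → Set where
  here : ∀ {x} → S x → Path S x x
  step : ∀ {x y z} → S x → Adjacent x y → Path S y z → Path S x z

Connected : (Box → Set) → Set
Connected S = Σ Box S × (∀ x y → S x → S y → Path S x y)

No2×2 : (Box → Set) → Set
No2×2 S = ∀ a c →
  ¬ (S (a , c) × S (suc a , c) × S (a , suc c) × S (suc a , suc c))

IsBorderStrip : ℕ → Partition → Partition → Set
IsBorderStrip r λ′ μ =
  (λ′ ⊆ₚ μ) × (skewSize λ′ μ ≡ r)
  × Connected (InSkew λ′ μ) × No2×2 (InSkew λ′ μ)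

-- row number of μ / λ: the least (0-indexed) row a with λ_a < μ_a,
-- i.e. the least index of a row the skew shape meets.
rowNumber : Partition → Partition → ℕ
rowNumber [] [] = 0
rowNumber [] (m ∷ ms) = if 0 <ᵇ m then 0 else suc (rowNumber [] ms)
rowNumber (l ∷ ls) [] = suc (rowNumber ls [])
rowNumber (l ∷ ls) (m ∷ ms) = if l <ᵇ m then 0 else suc (rowNumber ls ms)

steps : Partition → List Partition → List (Partition × Partition)
steps λ′ [] = []
steps λ′ (μ ∷ ms) = (λ′ , μ) ∷ steps μ ms

lastOf : Partition → List Partition → Partition
lastOf λ′ [] = λ′
lastOf λ′ (μ ∷ ms) = lastOf μ ms

rowNumberOf : Partition × Partition → ℕ
rowNumberOf (λ′ , μ) = rowNumber λ′ μ

-- μ / λ is a horizontal r-ribbon strip of size r q, together with its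
-- decomposition λ = σ^(0) ⊂ σ^(1) ⊂ ... ⊂ σ^(q) = μ (the list holds
-- σ^(1) ... σ^(q)); the decomposition is unique, so carrying it as data
-- is harmless.
HorizontalRibbonStrip : ℕ → Partition → Partition → ℕ → Set
HorizontalRibbonStrip r λ′ μ q =
  Σ (List Partition) λ σs →
    (length σs ≡ q) × (lastOf λ′ σs ≡ μ) × All IsPartition σs
    × All (λ p → IsBorderStrip r (proj₁ p) (proj₂ p)) (steps λ′ σs)
    × Linked (λ a b → b ≤ a) (map rowNumberOf (steps λ′ σs))

-- chain τ = ρ^(0) ⊂ ... ⊂ ρ^(ℓ) = ν with ρ^(j)/ρ^(j-1) a horizontal
-- r-ribbon strip of size r α_j
data RibbonChain (r : ℕ) : Partition → List ℕ → Partition → Set where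
  done : ∀ {λ′} → RibbonChain r λ′ [] λ′
  next : ∀ {λ′ μ ν q α} → HorizontalRibbonStrip r λ′ μ q →
         RibbonChain r μ α ν → RibbonChain r λ′ (q ∷ α) ν

RibbonTableau : ℕ → Partition → Partition → List ℕ → Set
RibbonTableau r ν τ α = IsPartition τ × RibbonChain r τ α ν

-- all r-border strips of the tableau with their labels: the ribbon strip
-- ρ^(j)/ρ^(j-1) gets label j (labels start at 1)
labelledStrips : ∀ {r λ′ α ν} → ℕ → RibbonChain r λ′ α ν →
                 List (ℕ × (Partition × Partition))
labelledStrips j done = []
labelledStrips {λ′ = λ′} j (next {q = q} h rest) =
  map (λ s → (j , s)) (steps λ′ (proj₁ h)) ++ labelledStrips (suc j) rest

strips : ∀ {r ν τ α} → RibbonTableau r ν τ α → List (ℕ × (Partition × Partition))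
strips T = labelledStrips 1 (proj₂ T)

-- Box (a , c) is where the strip s = μ/λ is "first seen" when reading
-- columns left to right, each bottom to top: it lies in s, the box below
-- it is not in s, and s has no box in any column c' < c.
-- (All boxes of ν/τ have row < length ν and column < ν_0.)

firstSeenᵇ : ℕ → Partition × Partition → Box → Bool
firstSeenᵇ H (λ′ , μ) (a , c) =
  inSkewᵇ λ′ μ (a , c) ∧ not (inSkewᵇ λ′ μ (suc a , c))
  ∧ not (any (λ c′ → any (λ a′ → inSkewᵇ λ′ μ (a′ , c′)) (upTo H)) (upTo c))

columnWord : ∀ {r ν τ α} → RibbonTableau r ν τ α → List ℕ
columnWord {ν = ν} T =
  concatMap (λ c →
    concatMap (λ a →
      concatMap (λ js → if firstSeenᵇ (length ν) (proj₂ js) (a , c)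
                          then proj₁ js ∷ [] else [])
                (strips T))
      (reverse (upTo (length ν))))
    (upTo (ν ! 0))

-- Since strips are listed in
-- order of weakly increasing label, each row below is weakly increasing.

rowNumberTableau : ∀ {r ν τ α} → RibbonTableau r ν τ α → List (List ℕ)
rowNumberTableau {ν = ν} T =
  map (λ a → map proj₁ (filterᵇ (λ js → rowNumberOf (proj₂ js) ≡ᵇ a) (strips T)))
      (upTo (length ν))

rowNumberWord : ∀ {r ν τ α} → RibbonTableau r ν τ α → List ℕ
rowNumberWord T = concat (reverse (rowNumberTableau T))

count : ℕ → List ℕ → ℕ
count k [] = 0
count k (x ∷ xs) = if x ≡ᵇ k then suc (count k xs) else count k xs

Latticed : List ℕ → Set
Latticed w = ∀ k → 1 ≤ k → ∀ n → count (suc k) (drop n w) ≤ count k (drop n w)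

-- Fix k ≥ 1. Reading the row-number word row by row, it suffices to show that the strips labelled
-- k + 1 with row number ≤ a are at most as many as the strips labelled k with row number < a.
-- Let c be the leftmost column in which one of the former, Q, is first seen. All of them are first
-- seen in columns ≥ c, so the lattice property of the column word, read from column c on, bounds
-- their number by the number of strips P labelled k first seen from column c on. Such a P lies
-- in columns ≥ c and inside the inner shape of Q, which has a box in column c; as P has no 2×2
-- square and Q is connected, and both have r boxes, P starts in a higher row than Q, so
-- rowNo P < rowNo Q ≤ a.

module Submission where

open import Defs
open import Data.Nat using (ℕ; zero; suc; _+_; _*_; _∸_; _≤_; _<_; _<ᵇ_; _≡ᵇ_; z≤n; s≤s; s≤s⁻¹; _⊔_; _≤?_; _<?_)
open import Data.Nat.Properties
open import Algebra.Properties.CommutativeSemigroup +-commutativeSemigroup using () renaming (interchange to +-interchange)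
open import Data.Nat.ListAction using (sum)
open import Data.Bool using (Bool; true; false; if_then_else_; T; not)
open import Data.Bool.Properties using (T-∧)
open import Data.Bool.ListAction using (any)
open import Data.List using (List; []; _∷_; _++_; length; upTo; applyUpTo; reverse; concatMap; map; drop; filterᵇ; concat; _∷ʳ_)
open import Data.List.Properties using (unfold-reverse; reverse-++; map-++; concatMap-++; upTo-∷ʳ)
open import Data.List.Membership.Propositional using (_∈_; find; lose)
open import Data.List.Membership.Propositional.Properties using (∈-upTo⁺; ∈-upTo⁻; ∈-map⁻; ∈-++⁻)
open import Data.List.Relation.Unary.Any using (here; there)
open import Data.List.Relation.Unary.Any.Properties using (any⁺; any⁻)
open import Data.List.Relation.Unary.All as All using (All; []; _∷_)
open import Data.List.Relation.Unary.AllPairs as AllPairs using ()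
open import Data.List.Relation.Unary.Unique.Propositional using (Unique)
open import Data.List.Relation.Unary.Unique.Propositional.Properties using (upTo⁺)
open import Data.Product using (_×_; _,_; proj₁; proj₂; ∃-syntax)
open import Data.Sum using (_⊎_; inj₁; inj₂)
open import Data.Empty using (⊥-elim)
open import Function using (Equivalence)
open import Relation.Nullary using (¬_; yes; no)
open import Relation.Binary using (tri<; tri≈; tri>)
open import Relation.Binary.PropositionalEquality

𝟙 : Bool → ℕ
𝟙 true = 1
𝟙 false = 0

𝟙≤1 : ∀ b → 𝟙 b ≤ 1
𝟙≤1 true = ≤-refl
𝟙≤1 false = z≤n

𝟙-pos : ∀ {b} → 1 ≤ 𝟙 b → T b
𝟙-pos {true} _ = _

T⇒𝟙-pos : ∀ {b} → T b → 1 ≤ 𝟙 b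
T⇒𝟙-pos {true} _ = ≤-refl

≤𝟙 : ∀ {n} b → n ≤ 1 → (1 ≤ n → T b) → n ≤ 𝟙 b
≤𝟙 {zero} b _ _ = z≤n
≤𝟙 {suc zero} b _ h with b | h ≤-refl
... | true | _ = ≤-refl
≤𝟙 {suc (suc n)} b (s≤s ()) _

𝟙*n-pos : ∀ b {n} → 1 ≤ 𝟙 b * n → T b × 1 ≤ n
𝟙*n-pos true {n} p = _ , subst (1 ≤_) (+-identityʳ n) p

*𝟙-≤ : ∀ n b → n * 𝟙 b ≤ n
*𝟙-≤ n true = ≤-reflexive (*-identityʳ n)
*𝟙-≤ n false = ≤-trans (≤-reflexive (*-zeroʳ n)) z≤n

𝟙<ᵇ-suc : ∀ x a → 𝟙 (x <ᵇ suc a) ≡ 𝟙 (x ≡ᵇ a) + 𝟙 (x <ᵇ a)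
𝟙<ᵇ-suc zero zero = refl
𝟙<ᵇ-suc zero (suc a) = refl
𝟙<ᵇ-suc (suc x) zero = refl
𝟙<ᵇ-suc (suc x) (suc a) = 𝟙<ᵇ-suc x a

∑ : {A : Set} → List A → (A → ℕ) → ℕ
∑ [] f = 0
∑ (x ∷ xs) f = f x + ∑ xs f

∑-syntax : {A : Set} → List A → (A → ℕ) → ℕ
∑-syntax = ∑

infix 6.5 ∑-syntax
syntax ∑-syntax xs (λ x → e) = ∑[ x ∈ xs ] e

module _ {A : Set} where

  ∑-cong : (xs : List A) {f g : A → ℕ} → (∀ x → f x ≡ g x) → ∑ xs f ≡ ∑ xs g
  ∑-cong [] e = refl
  ∑-cong (x ∷ xs) e = cong₂ _+_ (e x) (∑-cong xs e)

  ∑-mono-≤ : (xs : List A) {f g : A → ℕ} → (∀ x → x ∈ xs → f x ≤ g x) → ∑ xs f ≤ ∑ xs g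
  ∑-mono-≤ [] e = z≤n
  ∑-mono-≤ (x ∷ xs) e = +-mono-≤ (e x (here refl)) (∑-mono-≤ xs (λ y y∈ → e y (there y∈)))

  ∑-distrib-+ : (xs : List A) (f g : A → ℕ) → ∑[ x ∈ xs ] (f x + g x) ≡ ∑ xs f + ∑ xs g
  ∑-distrib-+ [] f g = refl
  ∑-distrib-+ (x ∷ xs) f g =
    trans (cong (f x + g x +_) (∑-distrib-+ xs f g)) (+-interchange (f x) (g x) (∑ xs f) (∑ xs g))

  ∑-*ˡ : (xs : List A) (k : ℕ) (f : A → ℕ) → ∑[ x ∈ xs ] (k * f x) ≡ k * ∑ xs f
  ∑-*ˡ [] k f = sym (*-zeroʳ k)
  ∑-*ˡ (x ∷ xs) k f = trans (cong (k * f x +_) (∑-*ˡ xs k f)) (sym (*-distribˡ-+ k (f x) _))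

  ∑-++ : (xs ys : List A) (f : A → ℕ) → ∑ (xs ++ ys) f ≡ ∑ xs f + ∑ ys f
  ∑-++ [] ys f = refl
  ∑-++ (x ∷ xs) ys f = trans (cong (f x +_) (∑-++ xs ys f)) (sym (+-assoc (f x) _ _))

  ∑-reverse : (xs : List A) (f : A → ℕ) → ∑ (reverse xs) f ≡ ∑ xs f
  ∑-reverse [] f = refl
  ∑-reverse (x ∷ xs) f = begin
    ∑ (reverse (x ∷ xs)) f       ≡⟨ cong (λ ys → ∑ ys f) (unfold-reverse x xs) ⟩
    ∑ (reverse xs ∷ʳ x) f        ≡⟨ ∑-++ (reverse xs) (x ∷ []) f ⟩
    ∑ (reverse xs) f + (f x + 0) ≡⟨ cong₂ _+_ (∑-reverse xs f) (+-identityʳ (f x)) ⟩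
    ∑ xs f + f x                 ≡⟨ +-comm (∑ xs f) (f x) ⟩
    f x + ∑ xs f                 ∎
    where open ≡-Reasoning

  ∑-zero : (xs : List A) (f : A → ℕ) → (∀ x → x ∈ xs → f x ≡ 0) → ∑ xs f ≡ 0
  ∑-zero [] f e = refl
  ∑-zero (x ∷ xs) f e = cong₂ _+_ (e x (here refl)) (∑-zero xs f (λ y y∈ → e y (there y∈)))

  ∈⇒≤∑ : (xs : List A) (f : A → ℕ) {x : A} → x ∈ xs → f x ≤ ∑ xs f
  ∈⇒≤∑ (y ∷ xs) f (here refl) = m≤m+n (f y) _
  ∈⇒≤∑ (y ∷ xs) f (there x∈) = ≤-trans (∈⇒≤∑ xs f x∈) (m≤n+m _ (f y))

  ∑-pos⇒∃ : (xs : List A) (f : A → ℕ) → 1 ≤ ∑ xs f → ∃[ x ] x ∈ xs × 1 ≤ f x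
  ∑-pos⇒∃ (x ∷ xs) f p with f x in fx
  ... | suc _ = x , here refl , subst (1 ≤_) (sym fx) (s≤s z≤n)
  ... | zero with ∑-pos⇒∃ xs f p
  ...   | y , y∈ , fy = y , there y∈ , fy

  ∑-≤1 : {xs : List A} (f : A → ℕ) → Unique xs → (∀ x → f x ≤ 1) →
         (∀ x y → 1 ≤ f x → 1 ≤ f y → x ≡ y) → ∑ xs f ≤ 1
  ∑-≤1 {[]} f _ _ _ = z≤n
  ∑-≤1 {x ∷ xs} f (x∉xs AllPairs.∷ uxs) f≤1 single with f x in fx
  ... | zero = ∑-≤1 f uxs f≤1 single
  ... | suc n = begin
    suc n + ∑ xs f ≡⟨ cong (suc n +_) (∑-zero xs f restZero) ⟩
    suc n + 0      ≡⟨ +-identityʳ (suc n) ⟩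
    suc n          ≡⟨ fx ⟨
    f x            ≤⟨ f≤1 x ⟩
    1              ∎
    where
    open ≤-Reasoning
    restZero : ∀ y → y ∈ xs → f y ≡ 0
    restZero y y∈ with f y in fy
    ... | zero = refl
    ... | suc _ = ⊥-elim (All.lookup x∉xs y∈
                    (single x y (subst (1 ≤_) (sym fx) (s≤s z≤n)) (subst (1 ≤_) (sym fy) (s≤s z≤n))))

∑-swap : {A B : Set} (xs : List A) (ys : List B) (f : A → B → ℕ) →
         ∑[ x ∈ xs ] ∑[ y ∈ ys ] f x y ≡ ∑[ y ∈ ys ] ∑[ x ∈ xs ] f x y
∑-swap [] ys f = sym (∑-zero ys (λ _ → 0) (λ _ _ → refl))
∑-swap (x ∷ xs) ys f =
  trans (cong (∑ ys (f x) +_) (∑-swap xs ys f)) (sym (∑-distrib-+ ys (f x) (λ y → ∑[ x′ ∈ xs ] f x′ y)))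

range : ℕ → ℕ → List ℕ
range c zero = []
range c (suc m) = c ∷ range (suc c) m

upTo≡range : ∀ n → upTo n ≡ range 0 n
upTo≡range n = applyUpTo≡range n (λ x → x) 0 (λ _ → refl)
  where
  applyUpTo≡range : ∀ n (f : ℕ → ℕ) c → (∀ x → f x ≡ c + x) → applyUpTo f n ≡ range c n
  applyUpTo≡range zero f c f≗c+ = refl
  applyUpTo≡range (suc n) f c f≗c+ = cong₂ _∷_ (trans (f≗c+ 0) (+-identityʳ c))
    (applyUpTo≡range n (λ x → f (suc x)) (suc c) (λ x → trans (f≗c+ (suc x)) (+-suc c x)))

range-++ : ∀ c m n → range c (m + n) ≡ range c m ++ range (c + m) n
range-++ c zero n = cong (λ x → range x n) (sym (+-identityʳ c))
range-++ c (suc m) n = cong (c ∷_) (trans (range-++ (suc c) m n) (cong (λ x → range (suc c) m ++ range x n) (sym (+-suc c m))))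

∈-range⁻ : ∀ {c m y} → y ∈ range c m → c ≤ y × y < c + m
∈-range⁻ {c} {suc m} (here refl) = ≤-refl , m<m+n c (s≤s z≤n)
∈-range⁻ {c} {suc m} {y} (there y∈) with ∈-range⁻ y∈
... | c<y , y<c+m = <⇒≤ c<y , subst (y <_) (sym (+-suc c m)) y<c+m

∈-range⁺ : ∀ {c m y} → c ≤ y → y < c + m → y ∈ range c m
∈-range⁺ {c} {zero} c≤y y<c+m = ⊥-elim (<⇒≱ y<c+m (subst (_≤ _) (sym (+-identityʳ c)) c≤y))
∈-range⁺ {c} {suc m} {y} c≤y y<c+m with m≤n⇒m<n∨m≡n c≤y
... | inj₂ refl = here refl
... | inj₁ c<y = there (∈-range⁺ c<y (subst (y <_) (+-suc c m) y<c+m))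

range-unique : ∀ c m → Unique (range c m)
range-unique c zero = AllPairs.[]
range-unique c (suc m) =
  All.tabulate (λ y∈ → <⇒≢ (proj₁ (∈-range⁻ y∈))) AllPairs.∷ range-unique (suc c) m

count-++ : ∀ k (xs ys : List ℕ) → count k (xs ++ ys) ≡ count k xs + count k ys
count-++ k [] ys = refl
count-++ k (x ∷ xs) ys with x ≡ᵇ k
... | true = cong suc (count-++ k xs ys)
... | false = count-++ k xs ys

count-concatMap : ∀ {A : Set} k (g : A → List ℕ) (xs : List A) →
                  count k (concatMap g xs) ≡ ∑[ x ∈ xs ] count k (g x)
count-concatMap k g [] = refl
count-concatMap k g (x ∷ xs) =
  trans (count-++ k (g x) (concatMap g xs)) (cong (count k (g x) +_) (count-concatMap k g xs))

count-if : ∀ k b l → count k (if b then l ∷ [] else []) ≡ 𝟙 b * 𝟙 (l ≡ᵇ k)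
count-if k true l with l ≡ᵇ k
... | true = refl
... | false = refl
count-if k false l = refl

count-map-filterᵇ : ∀ {A : Set} k (f : A → ℕ) (p : A → Bool) (xs : List A) →
                    count k (map f (filterᵇ p xs)) ≡ ∑[ x ∈ xs ] 𝟙 (p x) * 𝟙 (f x ≡ᵇ k)
count-map-filterᵇ k f p [] = refl
count-map-filterᵇ k f p (x ∷ xs) with p x
... | false = count-map-filterᵇ k f p xs
... | true with f x ≡ᵇ k
...   | true = cong suc (count-map-filterᵇ k f p xs)
...   | false = count-map-filterᵇ k f p xs

count-≤-∷ : ∀ k x (xs : List ℕ) → count k xs ≤ count k (x ∷ xs)
count-≤-∷ k x xs with x ≡ᵇ k
... | true = n≤1+n _
... | false = ≤-refl

LatticedAt : ℕ → List ℕ → Set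
LatticedAt k w = ∀ n → count (suc k) (drop n w) ≤ count k (drop n w)

latticedAt-[] : ∀ k → LatticedAt k []
latticedAt-[] k zero = z≤n
latticedAt-[] k (suc n) = z≤n

latticedAt-++ : ∀ k (xs : List ℕ) {ys} → LatticedAt k ys →
                count (suc k) (xs ++ ys) ≤ count k ys → LatticedAt k (xs ++ ys)
latticedAt-++ k xs {ys} lat bound zero =
  ≤-trans bound (subst (count k ys ≤_) (sym (count-++ k xs ys)) (m≤n+m _ _))
latticedAt-++ k [] lat bound (suc n) = lat (suc n)
latticedAt-++ k (x ∷ xs) lat bound (suc n) =
  latticedAt-++ k xs lat (≤-trans (count-≤-∷ (suc k) x (xs ++ _)) bound) n

-- Skew shapes

partition-antitone : ∀ p → IsPartition p → ∀ {x y} → x ≤ y → p ! y ≤ p ! x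
partition-antitone p pp x≤y with m≤n⇒m<n∨m≡n x≤y
... | inj₂ refl = ≤-refl
... | inj₁ (s≤s x≤y′) = ≤-trans (pp _) (partition-antitone p pp x≤y′)

!-beyond : ∀ (p : Partition) {x} → length p ≤ x → p ! x ≡ 0
!-beyond [] _ = refl
!-beyond (_ ∷ p) (s≤s le) = !-beyond p le

!-pos⇒<length : ∀ (p : Partition) {x y} → y < p ! x → x < length p
!-pos⇒<length p {x} y<px with length p ≤? x
... | yes le = ⊥-elim (<⇒≱ y<px (subst (_≤ _) (sym (!-beyond p le)) z≤n))
... | no nle = ≰⇒> nle

inSkew-row : ∀ l m {x y} → InSkew l m (x , y) → l ! x < m ! x
inSkew-row l m (l≤y , y<m) = ≤-<-trans l≤y y<m

rowNumber-spec : ∀ (l m : Partition) {x} → l ! x < m ! x →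
  l ! rowNumber l m < m ! rowNumber l m × (∀ y → y < rowNumber l m → m ! y ≤ l ! y)
rowNumber-spec [] [] ()
rowNumber-spec [] (m ∷ ms) {x} lx<mx with 0 <ᵇ m in e
... | true = <ᵇ⇒< 0 m (subst T (sym e) _) , λ _ ()
... | false with x | lx<mx
...   | zero | 0<m = ⊥-elim (subst T e (<⇒<ᵇ 0<m))
...   | suc x′ | lx<mx′ with rowNumber-spec [] ms lx<mx′
...     | nonempty , above = nonempty , λ where
          zero _ → ≮⇒≥ (λ 0<m → subst T e (<⇒<ᵇ 0<m))
          (suc y) (s≤s y<) → above y y<
rowNumber-spec (l ∷ ls) [] lx<mx = ⊥-elim (<⇒≱ lx<mx z≤n)
rowNumber-spec (l ∷ ls) (m ∷ ms) {x} lx<mx with l <ᵇ m in e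
... | true = <ᵇ⇒< l m (subst T (sym e) _) , λ _ ()
... | false with x | lx<mx
...   | zero | l<m = ⊥-elim (subst T e (<⇒<ᵇ l<m))
...   | suc x′ | lx<mx′ with rowNumber-spec ls ms lx<mx′
...     | nonempty , above = nonempty , λ where
          zero _ → ≮⇒≥ (λ l<m → subst T e (<⇒<ᵇ l<m))
          (suc y) (s≤s y<) → above y y<

no2×2⇒rows-overhang-≤1 : ∀ σ σ′ → IsPartition σ → IsPartition σ′ → No2×2 (InSkew σ σ′) →
                         ∀ i → σ′ ! suc i ≤ suc (σ ! i)
no2×2⇒rows-overhang-≤1 σ σ′ pσ pσ′ no2×2 i with σ′ ! suc i ≤? suc (σ ! i)
... | yes le = le
... | no nle = ⊥-elim (no2×2 i (σ ! i) (topLeft , bottomLeft , topRight , bottomRight))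
  where
  below : suc (σ ! i) < σ′ ! suc i
  below = ≰⇒> nle
  above : suc (σ ! i) < σ′ ! i
  above = <-≤-trans below (pσ′ i)
  topLeft : InSkew σ σ′ (i , σ ! i)
  topLeft = ≤-refl , <-trans (n<1+n _) above
  bottomLeft : InSkew σ σ′ (suc i , σ ! i)
  bottomLeft = pσ i , <-trans (n<1+n _) below
  topRight : InSkew σ σ′ (i , suc (σ ! i))
  topRight = n≤1+n _ , above
  bottomRight : InSkew σ σ′ (suc i , suc (σ ! i))
  bottomRight = ≤-trans (pσ i) (n≤1+n _) , below

pathHead : ∀ {S : Box → Set} {x y} → Path S x y → S x
pathHead (here s) = s
pathHead (step s _ _) = s

path-crosses : ∀ {S : Box → Set} i {u v} → Path S u v → proj₁ u ≤ i → i < proj₁ v →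
  ∃[ w ] ∃[ w′ ] S w × S w′ × Adjacent w w′ × proj₁ w ≤ i × i < proj₁ w′
path-crosses i (here _) u≤i i<v = ⊥-elim (<⇒≱ i<v u≤i)
path-crosses i (step {x} {y} sx adj p) x≤i i<v with proj₁ y ≤? i
... | yes y≤i = path-crosses i p y≤i i<v
... | no y≰i = x , y , sx , pathHead p , adj , x≤i , ≰⇒> y≰i

connected⇒rows-overlap : ∀ π μ → Connected (InSkew π μ) → ∀ {u v} i →
  InSkew π μ u → InSkew π μ v → proj₁ u ≤ i → i < proj₁ v → π ! i < μ ! suc i
connected⇒rows-overlap π μ (_ , paths) {u} {v} i su sv u≤i i<v
  with path-crosses i (paths u v su sv) u≤i i<v
... | _ , _ , _ , _ , inj₁ (refl , _) , w≤i , i<w′ = ⊥-elim (<⇒≱ i<w′ w≤i)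
... | (a , _) , (a′ , _) , _ , _ , inj₂ (refl , inj₂ refl) , w≤i , i<w′ = ⊥-elim (<⇒≱ i<w′ (≤-trans (n≤1+n a′) w≤i))
... | (a , b) , _ , sw , sw′ , inj₂ (refl , inj₁ refl) , w≤i , i<w′ with ≤-antisym w≤i (s≤s⁻¹ i<w′)
...   | refl = ≤-<-trans (proj₁ sw) (proj₂ sw′)

m∸n+n≡m⊔n : ∀ m n → (m ∸ n) + n ≡ m ⊔ n
m∸n+n≡m⊔n zero zero = refl
m∸n+n≡m⊔n zero (suc n) = refl
m∸n+n≡m⊔n (suc m) zero = cong suc (+-identityʳ m)
m∸n+n≡m⊔n (suc m) (suc n) = trans (+-suc (m ∸ n) n) (cong suc (m∸n+n≡m⊔n m n))

∑-range-shift : ∀ (f : ℕ → ℕ) c n → ∑[ i ∈ range (suc c) n ] f i ≡ ∑[ i ∈ range c n ] f (suc i)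
∑-range-shift f c zero = refl
∑-range-shift f c (suc n) = cong (f (suc c) +_) (∑-range-shift f (suc c) n)

sum≡∑-rows : ∀ (p : Partition) L → length p ≤ L → sum p ≡ ∑[ i ∈ range 0 L ] p ! i
sum≡∑-rows [] L _ = sym (∑-zero (range 0 L) (λ i → [] ! i) (λ _ _ → refl))
sum≡∑-rows (x ∷ p) (suc L) (s≤s len≤L) =
  cong (x +_) (trans (sum≡∑-rows p L len≤L) (sym (∑-range-shift ((x ∷ p) !_) 0 L)))

skewSize≡∑-rows : ∀ {l m} L → l ⊆ₚ m → length l ≤ L → length m ≤ L →
                  skewSize l m ≡ ∑[ i ∈ range 0 L ] (m ! i ∸ l ! i)
skewSize≡∑-rows {l} {m} L l⊆m lenl lenm = begin
  sum m ∸ sum l                                     ≡⟨ cong₂ _∸_ (sum≡∑-rows m L lenm) (sum≡∑-rows l L lenl) ⟩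
  ∑[ i ∈ rows ] m ! i ∸ ∑[ i ∈ rows ] l ! i         ≡⟨ cong (_∸ ∑[ i ∈ rows ] l ! i) split ⟩
  (∑[ i ∈ rows ] l ! i) + (∑[ i ∈ rows ] (m ! i ∸ l ! i)) ∸ ∑[ i ∈ rows ] l ! i
                                                    ≡⟨ m+n∸m≡n (∑[ i ∈ rows ] l ! i) _ ⟩
  ∑[ i ∈ rows ] (m ! i ∸ l ! i)                     ∎
  where
  open ≡-Reasoning
  rows : List ℕ
  rows = range 0 L
  split : ∑[ i ∈ rows ] m ! i ≡ (∑[ i ∈ rows ] l ! i) + (∑[ i ∈ rows ] (m ! i ∸ l ! i))
  split = trans (∑-cong rows (λ i → sym (m+[n∸m]≡n (l⊆m i)))) (∑-distrib-+ rows _ _)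

module _ (l m : Partition) (l⊆m : l ⊆ₚ m) (x n : ℕ) where

  private
    d : ℕ → ℕ
    d i = m ! i ∸ l ! i
    K : ℕ
    K = length l + length m

    skewSize-split : skewSize l m ≡ ((∑[ i ∈ range 0 x ] d i) + (∑[ i ∈ range x n ] d i)) + (∑[ i ∈ range (x + n) K ] d i)
    skewSize-split = begin
      skewSize l m
        ≡⟨ skewSize≡∑-rows {l} {m} (x + n + K) l⊆m (≤-trans (m≤m+n _ _) (m≤n+m K (x + n)))
                                                     (≤-trans (m≤n+m _ _) (m≤n+m K (x + n))) ⟩
      ∑[ i ∈ range 0 (x + n + K) ] d i
        ≡⟨ cong (λ is → ∑ is d) (trans (range-++ 0 (x + n) K) (cong (_++ range (x + n) K) (range-++ 0 x n))) ⟩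
      ∑ ((range 0 x ++ range x n) ++ range (x + n) K) d
        ≡⟨ trans (∑-++ (range 0 x ++ range x n) _ d) (cong (_+ ∑ (range (x + n) K) d) (∑-++ (range 0 x) _ d)) ⟩
      ((∑[ i ∈ range 0 x ] d i) + (∑[ i ∈ range x n ] d i)) + (∑[ i ∈ range (x + n) K ] d i) ∎
      where open ≡-Reasoning

  ∑-rows≤skewSize : ∑[ i ∈ range x n ] (m ! i ∸ l ! i) ≤ skewSize l m
  ∑-rows≤skewSize = ≤-trans (≤-trans (m≤n+m _ (∑ (range 0 x) d)) (m≤m+n _ (∑ (range (x + n) K) d)))
                            (≤-reflexive (sym skewSize-split))

  skewSize≡∑-rows-between : (∀ i → i < x ⊎ x + n ≤ i → m ! i ≤ l ! i) →
                            skewSize l m ≡ ∑[ i ∈ range x n ] (m ! i ∸ l ! i)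
  skewSize≡∑-rows-between outside = begin
    skewSize l m            ≡⟨ skewSize-split ⟩
    (above + between) + below ≡⟨ cong₂ (λ a b → (a + between) + b)
                                        (emptyRows 0 x (λ i∈ → inj₁ (proj₂ (∈-range⁻ i∈))))
                                        (emptyRows (x + n) K (λ i∈ → inj₂ (proj₁ (∈-range⁻ i∈)))) ⟩
    between + 0             ≡⟨ +-identityʳ between ⟩
    between                 ∎
    where
    open ≡-Reasoning
    above between below : ℕ
    above = ∑[ i ∈ range 0 x ] d i
    between = ∑[ i ∈ range x n ] d i
    below = ∑[ i ∈ range (x + n) K ] d i
    emptyRows : ∀ c k → (∀ {i} → i ∈ range c k → i < x ⊎ x + n ≤ i) → ∑[ i ∈ range c k ] d i ≡ 0
    emptyRows c k out = ∑-zero (range c k) d (λ i i∈ → m≤n⇒m∸n≡0 (outside i (out i∈)))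

module _ (f g : ℕ → ℕ) where

  private
    d : ℕ → ℕ
    d i = f i ∸ g i

    d+g : ∀ i → d i + g i ≡ f i ⊔ g i
    d+g i = m∸n+n≡m⊔n (f i) (g i)

  telescope-≤ : (∀ i → g (suc i) ≤ g i) → (∀ i → f (suc i) ≤ suc (g i)) →
                ∀ n x → (∑[ i ∈ range x (suc n) ] (f i ∸ g i)) + g (x + n) ≤ (f x ⊔ g x) + n
  telescope-≤ g-anti f-step zero x = begin
    (d x + 0) + g (x + 0) ≡⟨ cong₂ _+_ (+-identityʳ (d x)) (cong g (+-identityʳ x)) ⟩
    d x + g x             ≡⟨ d+g x ⟩
    f x ⊔ g x             ≡⟨ +-identityʳ _ ⟨
    (f x ⊔ g x) + 0       ∎
    where open ≤-Reasoning
  telescope-≤ g-anti f-step (suc n) x = begin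
    (d x + (∑[ i ∈ range (suc x) (suc n) ] d i)) + g (x + suc n)
      ≡⟨ trans (+-assoc (d x) _ _) (cong (λ y → d x + (∑[ i ∈ range (suc x) (suc n) ] d i + g y)) (+-suc x n)) ⟩
    d x + ((∑[ i ∈ range (suc x) (suc n) ] d i) + g (suc x + n))
      ≤⟨ +-monoʳ-≤ (d x) (telescope-≤ g-anti f-step n (suc x)) ⟩
    d x + ((f (suc x) ⊔ g (suc x)) + n)
      ≤⟨ +-monoʳ-≤ (d x) (+-monoˡ-≤ n (⊔-lub (f-step x) (≤-trans (g-anti x) (n≤1+n (g x))))) ⟩
    d x + (suc (g x) + n)
      ≡⟨ trans (cong (d x +_) (sym (+-suc (g x) n))) (sym (+-assoc (d x) (g x) (suc n))) ⟩
    (d x + g x) + suc n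
      ≡⟨ cong (_+ suc n) (d+g x) ⟩
    (f x ⊔ g x) + suc n ∎
    where open ≤-Reasoning

  telescope-≥ : ∀ n x → (∀ i → x ≤ i → i < x + n → g i < f (suc i)) →
                f x + n ≤ (∑[ i ∈ range x (suc n) ] (f i ∸ g i)) + g (x + n)
  telescope-≥ zero x _ = begin
    f x + 0               ≡⟨ +-identityʳ (f x) ⟩
    f x                   ≤⟨ m≤m⊔n (f x) (g x) ⟩
    f x ⊔ g x             ≡⟨ d+g x ⟨
    d x + g x             ≡⟨ cong₂ _+_ (+-identityʳ (d x)) (cong g (+-identityʳ x)) ⟨
    (d x + 0) + g (x + 0) ∎
    where open ≤-Reasoning
  telescope-≥ (suc n) x rowsOverlap = begin
    f x + suc n
      ≤⟨ +-monoˡ-≤ (suc n) (m≤m⊔n (f x) (g x)) ⟩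
    (f x ⊔ g x) + suc n
      ≡⟨ cong (_+ suc n) (d+g x) ⟨
    (d x + g x) + suc n
      ≡⟨ trans (+-assoc (d x) (g x) (suc n)) (cong (d x +_) (+-suc (g x) n)) ⟩
    d x + (suc (g x) + n)
      ≤⟨ +-monoʳ-≤ (d x) (+-monoˡ-≤ n (rowsOverlap x ≤-refl (m<m+n x (s≤s z≤n)))) ⟩
    d x + (f (suc x) + n)
      ≤⟨ +-monoʳ-≤ (d x) (telescope-≥ n (suc x)
           (λ i x<i i< → rowsOverlap i (<⇒≤ x<i) (subst (i <_) (sym (+-suc x n)) i<))) ⟩
    d x + ((∑[ i ∈ range (suc x) (suc n) ] d i) + g (suc x + n))
      ≡⟨ trans (cong (λ y → d x + (∑[ i ∈ range (suc x) (suc n) ] d i + g y)) (sym (+-suc x n))) (sym (+-assoc (d x) _ _)) ⟩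
    (d x + (∑[ i ∈ range (suc x) (suc n) ] d i)) + g (x + suc n) ∎
    where open ≤-Reasoning

no2×2⇒skewSize≤ : ∀ σ σ′ c h n → IsPartition σ → IsPartition σ′ → σ ⊆ₚ σ′ → No2×2 (InSkew σ σ′) →
  (∀ x y → InSkew σ σ′ (x , y) → c ≤ y) → σ ! h < σ′ ! h →
  (∀ i → i < h ⊎ h + suc n ≤ i → σ′ ! i ≤ σ ! i) →
  skewSize σ σ′ + c ≤ σ′ ! h + n
no2×2⇒skewSize≤ σ σ′ c h n pσ pσ′ σ⊆σ′ no2×2 columns≥c rowh outside = begin
  skewSize σ σ′ + c
    ≡⟨ cong (_+ c) (trans (skewSize≡∑-rows-between σ σ′ σ⊆σ′ h (suc n) outside)
                          (∑-cong (range h (suc n)) rowLength)) ⟩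
  (∑[ i ∈ range h (suc n) ] (σ′ ! i ∸ τ i)) + c
    ≤⟨ +-monoʳ-≤ _ (m≤n⊔m (σ ! (h + n)) c) ⟩
  (∑[ i ∈ range h (suc n) ] (σ′ ! i ∸ τ i)) + τ (h + n)
    ≤⟨ telescope-≤ (σ′ !_) τ (λ i → ⊔-monoˡ-≤ c (pσ i))
         (λ i → ≤-trans (no2×2⇒rows-overhang-≤1 σ σ′ pσ pσ′ no2×2 i) (s≤s (m≤m⊔n _ c))) n h ⟩
  (σ′ ! h ⊔ τ h) + n
    ≡⟨ cong (λ z → (σ′ ! h ⊔ z) + n) (m≥n⇒m⊔n≡m (columns≥c h (σ ! h) (≤-refl , rowh))) ⟩
  (σ′ ! h ⊔ σ ! h) + n
    ≡⟨ cong (_+ n) (m≥n⇒m⊔n≡m (<⇒≤ rowh)) ⟩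
  σ′ ! h + n ∎
  where
  open ≤-Reasoning
  -- replacing σ by σ ⊔ c changes no row length, since nonempty rows start in a column ≥ c
  τ : ℕ → ℕ
  τ i = σ ! i ⊔ c
  rowLength : ∀ i → σ′ ! i ∸ σ ! i ≡ σ′ ! i ∸ τ i
  rowLength i with σ ! i <? σ′ ! i
  ... | yes nonempty = cong (σ′ ! i ∸_) (sym (m≥n⇒m⊔n≡m (columns≥c i (σ ! i) (≤-refl , nonempty))))
  ... | no empty = trans (m≤n⇒m∸n≡0 (≮⇒≥ empty)) (sym (m≤n⇒m∸n≡0 (≤-trans (≮⇒≥ empty) (m≤m⊔n _ c))))

connected⇒skewSize≥ : ∀ π μ x n {y y′} → π ⊆ₚ μ → Connected (InSkew π μ) →
  InSkew π μ (x , y) → InSkew π μ (x + n , y′) → μ ! x + n ≤ skewSize π μ + π ! (x + n)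
connected⇒skewSize≥ π μ x n π⊆μ conn top bottom = begin
  μ ! x + n
    ≤⟨ telescope-≥ (μ !_) (π !_) n x (λ i x≤i i<x+n → connected⇒rows-overlap π μ conn i top bottom x≤i i<x+n) ⟩
  (∑[ i ∈ range x (suc n) ] (μ ! i ∸ π ! i)) + π ! (x + n)
    ≤⟨ +-monoˡ-≤ (π ! (x + n)) (∑-rows≤skewSize π μ π⊆μ x (suc n)) ⟩
  skewSize π μ + π ! (x + n) ∎
  where open ≤-Reasoning

rows-above : ∀ σ σ′ π {t c} → σ′ ⊆ₚ π → IsPartition π → π ! t ≤ c →
  (∀ x y → InSkew σ σ′ (x , y) → c ≤ y) → ∀ x y → InSkew σ σ′ (x , y) → x < t
rows-above σ σ′ π {t = t} σ′⊆π pπ πt≤c columns≥c x y box with t ≤? x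
... | no x≱t = ≰⇒> x≱t
... | yes t≤x = ⊥-elim (<⇒≱ (<-≤-trans (proj₂ box) (σ′⊆π x))
                              (≤-trans (partition-antitone π pπ t≤x) (≤-trans πt≤c (columns≥c x y box))))

-- If rowNumber π μ ≤ h = rowNumber σ σ′, the r boxes of σ′/σ lie in the rows h … t - 1 and in
-- columns ≥ c, so r + c ≤ σ′ ! h + (t - 1 - h); but the connected μ/π runs from its first row down
-- to the box (t , c), which forces r + c to be larger.
rowNumber-< : ∀ {r} σ σ′ π μ {t c} → IsPartition σ → IsPartition σ′ → IsPartition π →
  IsBorderStrip r σ σ′ → IsBorderStrip r π μ → σ′ ⊆ₚ π →
  InSkew π μ (t , c) → (∀ x y → InSkew σ σ′ (x , y) → c ≤ y) →
  rowNumber σ σ′ < rowNumber π μ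
rowNumber-< {r} σ σ′ π μ {t} {c} pσ pσ′ pπ
  (σ⊆σ′ , sizeP , ((_ , boxP) , _) , no2×2P) (π⊆μ , sizeQ , connQ , _) σ′⊆π boxQ columns≥c
  with rowNumber σ σ′ <? rowNumber π μ
... | yes lt = lt
... | no nlt = ⊥-elim (<-irrefl refl (begin-strict
  r + c                         ≤⟨ upper ⟩
  σ′ ! h + n                    <⟨ +-mono-<-≤ (≤-<-trans σ′h≤πhQ rowQ) n≤n′ ⟩
  μ ! hQ + n′                   ≤⟨ connected⇒skewSize≥ π μ hQ n′ π⊆μ connQ (≤-refl , rowQ) boxQ′ ⟩
  skewSize π μ + π ! (hQ + n′)  ≤⟨ +-mono-≤ (≤-reflexive sizeQ) (subst (λ x → π ! x ≤ c) (sym hQ+n′≡t) (proj₁ boxQ)) ⟩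
  r + c                         ∎))
  where
  open ≤-Reasoning
  h hQ n n′ : ℕ
  h = rowNumber σ σ′
  hQ = rowNumber π μ
  hQ≤h : hQ ≤ h
  hQ≤h = ≮⇒≥ nlt
  rowP : σ ! h < σ′ ! h
  rowP = proj₁ (rowNumber-spec σ σ′ (inSkew-row σ σ′ boxP))
  σ′h≤πhQ : σ′ ! h ≤ π ! hQ
  σ′h≤πhQ = ≤-trans (σ′⊆π h) (partition-antitone π pπ hQ≤h)
  rowQ : π ! hQ < μ ! hQ
  rowQ = proj₁ (rowNumber-spec π μ (inSkew-row π μ boxQ))
  rowsP<t : ∀ x y → InSkew σ σ′ (x , y) → x < t
  rowsP<t = rows-above σ σ′ π σ′⊆π pπ (proj₁ boxQ) columns≥c
  h<t : h < t
  h<t = rowsP<t h (σ ! h) (≤-refl , rowP)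
  n = t ∸ suc h
  n′ = t ∸ hQ
  hQ+n′≡t : hQ + n′ ≡ t
  hQ+n′≡t = m+[n∸m]≡n (≤-trans hQ≤h (<⇒≤ h<t))
  boxQ′ : InSkew π μ (hQ + n′ , c)
  boxQ′ = subst (λ x → InSkew π μ (x , c)) (sym hQ+n′≡t) boxQ
  n≤n′ : n ≤ n′
  n≤n′ = ∸-monoʳ-≤ t (≤-trans hQ≤h (n≤1+n h))
  outsideP : ∀ i → i < h ⊎ h + suc n ≤ i → σ′ ! i ≤ σ ! i
  outsideP i (inj₁ i<h) = proj₂ (rowNumber-spec σ σ′ rowP) i i<h
  outsideP i (inj₂ t≤i) with σ ! i <? σ′ ! i
  ... | no empty = ≮⇒≥ empty
  ... | yes nonempty = ⊥-elim (<⇒≱ (rowsP<t i (σ ! i) (≤-refl , nonempty))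
                                  (subst (_≤ i) (trans (+-suc h n) (m+[n∸m]≡n h<t)) t≤i))
  upper : r + c ≤ σ′ ! h + n
  upper = subst (λ z → z + c ≤ σ′ ! h + n) sizeP
    (no2×2⇒skewSize≤ σ σ′ c h n pσ pσ′ σ⊆σ′ no2×2P columns≥c rowP outsideP)

-- The box where a strip is first seen

T-not⁻ : ∀ {b} → T (not b) → ¬ T b
T-not⁻ {false} _ ()

T-not⁺ : ∀ {b} → ¬ T b → T (not b)
T-not⁺ {false} _ = _
T-not⁺ {true} ¬t = ¬t _

inSkewᵇ⁻ : ∀ l m {b} → T (inSkewᵇ l m b) → InSkew l m b
inSkewᵇ⁻ l m {a , c} t with Equivalence.to T-∧ t
... | l≤c , c<m = ≮⇒≥ (λ c<l → T-not⁻ l≤c (<⇒<ᵇ c<l)) , <ᵇ⇒< c (m ! a) c<m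

inSkewᵇ⁺ : ∀ l m {b} → InSkew l m b → T (inSkewᵇ l m b)
inSkewᵇ⁺ l m {a , c} (l≤c , c<m) =
  Equivalence.from T-∧ (T-not⁺ (λ c<l → <⇒≱ (<ᵇ⇒< c (l ! a) c<l) l≤c) , <⇒<ᵇ c<m)

record FirstSeen (H : ℕ) (l m : Partition) (a c : ℕ) : Set where
  field
    box : InSkew l m (a , c)
    bottom : ¬ InSkew l m (suc a , c)
    leftmost : ∀ a′ c′ → a′ < H → c′ < c → ¬ InSkew l m (a′ , c′)

firstSeenᵇ⁻ : ∀ H l m {a c} → T (firstSeenᵇ H (l , m) (a , c)) → FirstSeen H l m a c
firstSeenᵇ⁻ H l m {a} {c} t with Equivalence.to T-∧ t
... | inBox , rest with Equivalence.to T-∧ rest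
...   | notBelow , notLeft = record
  { box = inSkewᵇ⁻ l m inBox
  ; bottom = λ below → T-not⁻ notBelow (inSkewᵇ⁺ l m below)
  ; leftmost = λ a′ c′ a′<H c′<c left → T-not⁻ notLeft
      (any⁺ _ (lose (∈-upTo⁺ c′<c) (any⁺ _ (lose (∈-upTo⁺ a′<H) (inSkewᵇ⁺ l m left)))))
  }

firstSeenᵇ⁺ : ∀ H l m {a c} → FirstSeen H l m a c → T (firstSeenᵇ H (l , m) (a , c))
firstSeenᵇ⁺ H l m {a} {c} fs =
  Equivalence.from T-∧ (inSkewᵇ⁺ l m box ,
    Equivalence.from T-∧ (T-not⁺ (λ t → bottom (inSkewᵇ⁻ l m t)) , T-not⁺ noneLeft))
  where
  open FirstSeen fs
  noneLeft : ¬ T (any (λ c′ → any (λ a′ → inSkewᵇ l m (a′ , c′)) (upTo H)) (upTo c))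
  noneLeft t with find (any⁻ _ _ t)
  ... | c′ , c′∈ , t′ with find (any⁻ _ _ t′)
  ...   | a′ , a′∈ , t″ = leftmost a′ c′ (∈-upTo⁻ a′∈) (∈-upTo⁻ c′∈) (inSkewᵇ⁻ l m t″)

module _ (l m : Partition) (pl : IsPartition l) (pm : IsPartition m)
         (H : ℕ) (rows<H : ∀ x y → InSkew l m (x , y) → x < H) where

  firstSeen-leftmost : ∀ {a c} → FirstSeen H l m a c → ∀ x y → InSkew l m (x , y) → c ≤ y
  firstSeen-leftmost {c = c} fs x y b with c ≤? y
  ... | yes c≤y = c≤y
  ... | no c≰y = ⊥-elim (FirstSeen.leftmost fs x y (rows<H x y b) (≰⇒> c≰y) b)

  private
    not-above : ∀ {a a′ c} → FirstSeen H l m a c → FirstSeen H l m a′ c → ¬ a < a′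
    not-above fs fs′ a<a′ = FirstSeen.bottom fs
      ( ≤-trans (pl _) (proj₁ (FirstSeen.box fs))
      , <-≤-trans (proj₂ (FirstSeen.box fs′)) (partition-antitone m pm a<a′))

  firstSeen-unique : ∀ {a c a′ c′} → FirstSeen H l m a c → FirstSeen H l m a′ c′ → a ≡ a′ × c ≡ c′
  firstSeen-unique {a} {c} {a′} fs fs′
    with ≤-antisym (firstSeen-leftmost fs a′ _ (FirstSeen.box fs′)) (firstSeen-leftmost fs′ a _ (FirstSeen.box fs))
  ... | refl with <-cmp a a′
  ...   | tri< a<a′ _ _ = ⊥-elim (not-above fs fs′ a<a′)
  ...   | tri≈ _ a≡a′ _ = a≡a′ , refl
  ...   | tri> _ _ a′<a = ⊥-elim (not-above fs′ fs a′<a)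

  private
    Nonempty : ℕ → Set
    Nonempty x = l ! x < m ! x

    lastNonempty : ∀ n x → x < n → Nonempty x → ∃[ a ] Nonempty a × (∀ a′ → a < a′ → a′ < n → ¬ Nonempty a′)
    lastNonempty (suc n) x x<1+n nonempty with l ! n <? m ! n
    ... | yes nonempty-n = n , nonempty-n , λ a′ n<a′ a′<1+n _ → <⇒≱ a′<1+n n<a′
    ... | no empty-n with m≤n⇒m<n∨m≡n (s≤s⁻¹ x<1+n)
    ...   | inj₂ refl = ⊥-elim (empty-n nonempty)
    ...   | inj₁ x<n with lastNonempty n x x<n nonempty
    ...     | a , nonempty-a , after = a , nonempty-a , λ where
              a′ a<a′ a′<1+n → emptyAfter a′ a<a′ (m≤n⇒m<n∨m≡n (s≤s⁻¹ a′<1+n))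
      where
      emptyAfter : ∀ a′ → a < a′ → a′ < n ⊎ a′ ≡ n → ¬ Nonempty a′
      emptyAfter a′ a<a′ (inj₁ a′<n) = after a′ a<a′ a′<n
      emptyAfter a′ _ (inj₂ refl) = empty-n

  -- the strip is first seen at the start of its lowest row
  firstSeen-exists : ∀ {x y} → InSkew l m (x , y) → ∃[ a ] FirstSeen H l m a (l ! a)
  firstSeen-exists {x} {y} b with lastNonempty H x (rows<H x y b) (inSkew-row l m b)
  ... | a , nonempty-a , after = a , record
    { box = ≤-refl , nonempty-a
    ; bottom = λ below → empty (suc a) ≤-refl (≤-<-trans (pl a) (proj₂ below))
    ; leftmost = λ a′ c′ _ c′<la left →
        <⇒≱ c′<la (≤-trans (partition-antitone l pl (notBelow a′ (inSkew-row l m left))) (proj₁ left))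
    }
    where
    empty : ∀ a′ → a < a′ → ¬ Nonempty a′
    empty a′ a<a′ nonempty with a′ <? H
    ... | yes a′<H = after a′ a<a′ a′<H nonempty
    ... | no a′≮H = a′≮H (rows<H a′ (l ! a′) (≤-refl , nonempty))
    notBelow : ∀ a′ → Nonempty a′ → a′ ≤ a
    notBelow a′ nonempty with a′ ≤? a
    ... | yes a′≤a = a′≤a
    ... | no a′≰a = ⊥-elim (empty a′ (≰⇒> a′≰a) nonempty)

-- The border strips of a ribbon tableau

LabelledStrip : Set
LabelledStrip = ℕ × (Partition × Partition)

label : LabelledStrip → ℕ
label = proj₁

inner outer : LabelledStrip → Partition
inner s = proj₁ (proj₂ s)
outer s = proj₂ (proj₂ s)

rowNo : LabelledStrip → ℕ
rowNo s = rowNumberOf (proj₂ s)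

-- stated for functions rather than partitions so that the implicit arguments can be inferred
⊆ₚ-trans : ∀ {f g h : ℕ → ℕ} → (∀ i → f i ≤ g i) → (∀ i → g i ≤ h i) → ∀ i → f i ≤ h i
⊆ₚ-trans f≤g g≤h i = ≤-trans (f≤g i) (g≤h i)

IsBorderStripStep : ℕ → Partition × Partition → Set
IsBorderStripStep r p = IsBorderStrip r (proj₁ p) (proj₂ p)

lastOf-partition : ∀ {λ′} σs → IsPartition λ′ → All IsPartition σs → IsPartition (lastOf λ′ σs)
lastOf-partition [] pλ _ = pλ
lastOf-partition (σ ∷ σs) _ (pσ ∷ pσs) = lastOf-partition σs pσ pσs

lastOf-⊇ : ∀ {r} λ′ σs → All (IsBorderStripStep r) (steps λ′ σs) → λ′ ⊆ₚ lastOf λ′ σs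
lastOf-⊇ λ′ [] _ = (λ _ → ≤-refl)
lastOf-⊇ λ′ (σ ∷ σs) (bs ∷ bss) = ⊆ₚ-trans (proj₁ bs) (lastOf-⊇ σ σs bss)

steps-partitions : ∀ {λ′} σs → IsPartition λ′ → All IsPartition σs →
  ∀ {p} → p ∈ steps λ′ σs → IsPartition (proj₁ p) × IsPartition (proj₂ p)
steps-partitions (σ ∷ σs) pλ (pσ ∷ _) (here refl) = pλ , pσ
steps-partitions (σ ∷ σs) _ (pσ ∷ pσs) (there p∈) = steps-partitions σs pσ pσs p∈

steps-between : ∀ {r} λ′ σs → All (IsBorderStripStep r) (steps λ′ σs) →
  ∀ {p} → p ∈ steps λ′ σs → λ′ ⊆ₚ proj₁ p × proj₂ p ⊆ₚ lastOf λ′ σs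
steps-between λ′ (σ ∷ σs) (_ ∷ bss) (here refl) = (λ _ → ≤-refl) , lastOf-⊇ σ σs bss
steps-between λ′ (σ ∷ σs) (bs ∷ bss) (there p∈) with steps-between σ σs bss p∈
... | σ⊆p , p⊆last = ⊆ₚ-trans (proj₁ bs) σ⊆p , p⊆last

horizontalRibbonStrip-⊆ : ∀ {r λ′ μ q} → HorizontalRibbonStrip r λ′ μ q → λ′ ⊆ₚ μ
horizontalRibbonStrip-⊆ {λ′ = λ′} (σs , _ , refl , _ , bss , _) = lastOf-⊇ λ′ σs bss

ribbonChain-partition : ∀ {r λ′ α ν} → RibbonChain r λ′ α ν → IsPartition λ′ → IsPartition ν
ribbonChain-partition done pλ = pλ
ribbonChain-partition (next (σs , _ , refl , pσs , _) rest) pλ =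
  ribbonChain-partition rest (lastOf-partition σs pλ pσs)

ribbonChain-⊆ : ∀ {r λ′ α ν} → RibbonChain r λ′ α ν → λ′ ⊆ₚ ν
ribbonChain-⊆ done = (λ _ → ≤-refl)
ribbonChain-⊆ (next h rest) = ⊆ₚ-trans (horizontalRibbonStrip-⊆ h) (ribbonChain-⊆ rest)

record IsStripIn (r : ℕ) (ν : Partition) (s : LabelledStrip) : Set where
  field
    inner-partition : IsPartition (inner s)
    outer-partition : IsPartition (outer s)
    borderStrip : IsBorderStrip r (inner s) (outer s)
    outer⊆ν : outer s ⊆ₚ ν

∈-labelledStrips⁻ : ∀ {r λ′ μ ν q α} j (h : HorizontalRibbonStrip r λ′ μ q) (rest : RibbonChain r μ α ν) →
  ∀ {s} → s ∈ labelledStrips j (next h rest) →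
  (∃[ p ] p ∈ steps λ′ (proj₁ h) × s ≡ (j , p)) ⊎ s ∈ labelledStrips (suc j) rest
∈-labelledStrips⁻ {λ′ = λ′} j h rest s∈ with ∈-++⁻ (map (j ,_) (steps λ′ (proj₁ h))) s∈
... | inj₁ s∈block = inj₁ (∈-map⁻ (j ,_) s∈block)
... | inj₂ s∈rest = inj₂ s∈rest

labelledStrips-isStripIn : ∀ {r λ′ α ν} (ch : RibbonChain r λ′ α ν) j → IsPartition λ′ →
  ∀ {s} → s ∈ labelledStrips j ch → IsStripIn r ν s
labelledStrips-isStripIn (next h@(σs , _ , refl , pσs , bss , _) rest) j pλ s∈
  with ∈-labelledStrips⁻ j h rest s∈
... | inj₂ s∈rest = labelledStrips-isStripIn rest (suc j) (lastOf-partition σs pλ pσs) s∈rest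
... | inj₁ (p , p∈ , refl) = record
  { inner-partition = proj₁ (steps-partitions σs pλ pσs p∈)
  ; outer-partition = proj₂ (steps-partitions σs pλ pσs p∈)
  ; borderStrip = All.lookup bss p∈
  ; outer⊆ν = ⊆ₚ-trans (proj₂ (steps-between _ σs bss p∈)) (ribbonChain-⊆ rest)
  }

labelledStrips-bounds : ∀ {r λ′ α ν} (ch : RibbonChain r λ′ α ν) j →
  ∀ {s} → s ∈ labelledStrips j ch → λ′ ⊆ₚ inner s × j ≤ label s
labelledStrips-bounds (next h@(σs , _ , _ , _ , bss , _) rest) j s∈ with ∈-labelledStrips⁻ j h rest s∈
... | inj₁ (p , p∈ , refl) = proj₁ (steps-between _ σs bss p∈) , ≤-refl
... | inj₂ s∈rest with labelledStrips-bounds rest (suc j) s∈rest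
...   | μ⊆inner , j<label = ⊆ₚ-trans (horizontalRibbonStrip-⊆ h) μ⊆inner , <⇒≤ j<label

labelledStrips-ordered : ∀ {r λ′ α ν} (ch : RibbonChain r λ′ α ν) j →
  ∀ {P Q} → P ∈ labelledStrips j ch → Q ∈ labelledStrips j ch → label P < label Q → outer P ⊆ₚ inner Q
labelledStrips-ordered (next h@(σs , _ , refl , _ , bss , _) rest) j P∈ Q∈ P<Q
  with ∈-labelledStrips⁻ j h rest P∈ | ∈-labelledStrips⁻ j h rest Q∈
... | inj₁ (_ , _ , refl) | inj₁ (_ , _ , refl) = ⊥-elim (<-irrefl refl P<Q)
... | inj₁ (p , p∈ , refl) | inj₂ Q∈rest =
  ⊆ₚ-trans (proj₂ (steps-between _ σs bss p∈)) (proj₁ (labelledStrips-bounds rest (suc j) Q∈rest))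
... | inj₂ P∈rest | inj₁ (_ , _ , refl) = ⊥-elim (<⇒≱ P<Q (<⇒≤ (proj₂ (labelledStrips-bounds rest (suc j) P∈rest))))
... | inj₂ P∈rest | inj₂ Q∈rest = labelledStrips-ordered rest (suc j) P∈rest Q∈rest P<Q

-- The row-number word and the column word

module RowWord (S : List LabelledStrip) where

  #labelled_rowNo<_ : ℕ → ℕ → ℕ
  #labelled j rowNo< a = ∑[ s ∈ S ] 𝟙 (label s ≡ᵇ j) * 𝟙 (rowNo s <ᵇ a)

  row : ℕ → List ℕ
  row a = map label (filterᵇ (λ s → rowNo s ≡ᵇ a) S)

  firstRows : ℕ → List ℕ
  firstRows a = concat (reverse (map row (upTo a)))

  firstRows-suc : ∀ a → firstRows (suc a) ≡ row a ++ firstRows a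
  firstRows-suc a = begin
    concat (reverse (map row (upTo (suc a))))         ≡⟨ cong (λ xs → concat (reverse (map row xs))) (upTo-∷ʳ a) ⟨
    concat (reverse (map row (upTo a ++ a ∷ [])))     ≡⟨ cong (λ xs → concat (reverse xs)) (map-++ row (upTo a) (a ∷ [])) ⟩
    concat (reverse (map row (upTo a) ++ row a ∷ [])) ≡⟨ cong concat (reverse-++ (map row (upTo a)) (row a ∷ [])) ⟩
    row a ++ firstRows a                              ∎
    where open ≡-Reasoning

  count-firstRows : ∀ j a → count j (firstRows a) ≡ #labelled j rowNo< a
  count-firstRows j zero = sym (∑-zero S _ (λ s _ → *-zeroʳ (𝟙 (label s ≡ᵇ j))))
  count-firstRows j (suc a) = begin
    count j (firstRows (suc a))
      ≡⟨ cong (count j) (firstRows-suc a) ⟩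
    count j (row a ++ firstRows a)
      ≡⟨ count-++ j (row a) (firstRows a) ⟩
    count j (row a) + count j (firstRows a)
      ≡⟨ cong₂ _+_ (count-map-filterᵇ j label (λ s → rowNo s ≡ᵇ a) S) (count-firstRows j a) ⟩
    (∑[ s ∈ S ] 𝟙 (rowNo s ≡ᵇ a) * 𝟙 (label s ≡ᵇ j)) + #labelled j rowNo< a
      ≡⟨ ∑-distrib-+ S _ _ ⟨
    ∑[ s ∈ S ] (𝟙 (rowNo s ≡ᵇ a) * 𝟙 (label s ≡ᵇ j) + 𝟙 (label s ≡ᵇ j) * 𝟙 (rowNo s <ᵇ a))
      ≡⟨ ∑-cong S split ⟩
    #labelled j rowNo< suc a ∎
    where
    open ≡-Reasoning
    split : ∀ s → 𝟙 (rowNo s ≡ᵇ a) * 𝟙 (label s ≡ᵇ j) + 𝟙 (label s ≡ᵇ j) * 𝟙 (rowNo s <ᵇ a)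
                ≡ 𝟙 (label s ≡ᵇ j) * 𝟙 (rowNo s <ᵇ suc a)
    split s = begin
      𝟙 (rowNo s ≡ᵇ a) * 𝟙 (label s ≡ᵇ j) + 𝟙 (label s ≡ᵇ j) * 𝟙 (rowNo s <ᵇ a)
        ≡⟨ cong (_+ 𝟙 (label s ≡ᵇ j) * 𝟙 (rowNo s <ᵇ a)) (*-comm (𝟙 (rowNo s ≡ᵇ a)) _) ⟩
      𝟙 (label s ≡ᵇ j) * 𝟙 (rowNo s ≡ᵇ a) + 𝟙 (label s ≡ᵇ j) * 𝟙 (rowNo s <ᵇ a)
        ≡⟨ *-distribˡ-+ (𝟙 (label s ≡ᵇ j)) _ _ ⟨
      𝟙 (label s ≡ᵇ j) * (𝟙 (rowNo s ≡ᵇ a) + 𝟙 (rowNo s <ᵇ a))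
        ≡⟨ cong (𝟙 (label s ≡ᵇ j) *_) (𝟙<ᵇ-suc (rowNo s) a) ⟨
      𝟙 (label s ≡ᵇ j) * 𝟙 (rowNo s <ᵇ suc a) ∎

  latticedAt-firstRows : ∀ k → (∀ a → #labelled suc k rowNo< suc a ≤ #labelled k rowNo< a) →
                         ∀ a → LatticedAt k (firstRows a)
  latticedAt-firstRows k rowBound zero = latticedAt-[] k
  latticedAt-firstRows k rowBound (suc a) =
    subst (LatticedAt k) (sym (firstRows-suc a))
      (latticedAt-++ k (row a) (latticedAt-firstRows k rowBound a) (begin
        count (suc k) (row a ++ firstRows a)  ≡⟨ cong (count (suc k)) (firstRows-suc a) ⟨
        count (suc k) (firstRows (suc a))     ≡⟨ count-firstRows (suc k) (suc a) ⟩
        #labelled suc k rowNo< suc a          ≤⟨ rowBound a ⟩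
        #labelled k rowNo< a                  ≡⟨ count-firstRows k a ⟨
        count k (firstRows a)                 ∎))
    where open ≤-Reasoning

drop-++ : {A : Set} (xs ys : List A) → drop (length xs) (xs ++ ys) ≡ ys
drop-++ [] ys = refl
drop-++ (x ∷ xs) ys = drop-++ xs ys

module ColumnWord (S : List LabelledStrip) (H : ℕ) (firstSeen : LabelledStrip → Box → Bool) where

  open RowWord S using (#labelled_rowNo<_)

  column : ℕ → List ℕ
  column c = concatMap (λ a → concatMap (λ s → if firstSeen s (a , c) then label s ∷ [] else []) S)
                       (reverse (upTo H))

  seenIn : LabelledStrip → ℕ → ℕ
  seenIn s c = ∑[ a ∈ upTo H ] 𝟙 (firstSeen s (a , c))

  seenInColumns : LabelledStrip → ℕ → ℕ → ℕ
  seenInColumns s c m = ∑[ c′ ∈ range c m ] seenIn s c′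

  count-column : ∀ j c → count j (column c) ≡ ∑[ s ∈ S ] 𝟙 (label s ≡ᵇ j) * seenIn s c
  count-column j c = begin
    count j (column c)
      ≡⟨ count-concatMap j _ (reverse (upTo H)) ⟩
    ∑[ a ∈ reverse (upTo H) ] count j (entries a)
      ≡⟨ ∑-reverse (upTo H) _ ⟩
    ∑[ a ∈ upTo H ] count j (entries a)
      ≡⟨ ∑-cong (upTo H) (λ a → trans (count-concatMap j _ S) (∑-cong S (λ s → count-if j (firstSeen s (a , c)) (label s)))) ⟩
    ∑[ a ∈ upTo H ] ∑[ s ∈ S ] 𝟙 (firstSeen s (a , c)) * 𝟙 (label s ≡ᵇ j)
      ≡⟨ ∑-swap (upTo H) S _ ⟩
    ∑[ s ∈ S ] ∑[ a ∈ upTo H ] 𝟙 (firstSeen s (a , c)) * 𝟙 (label s ≡ᵇ j)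
      ≡⟨ ∑-cong S (λ s → trans (∑-cong (upTo H) (λ a → *-comm (𝟙 (firstSeen s (a , c))) _))
                               (∑-*ˡ (upTo H) (𝟙 (label s ≡ᵇ j)) _)) ⟩
    ∑[ s ∈ S ] 𝟙 (label s ≡ᵇ j) * seenIn s c ∎
    where
    open ≡-Reasoning
    entries : ℕ → List ℕ
    entries a = concatMap (λ s → if firstSeen s (a , c) then label s ∷ [] else []) S

  count-columns : ∀ j c m →
    count j (concatMap column (range c m)) ≡ ∑[ s ∈ S ] 𝟙 (label s ≡ᵇ j) * seenInColumns s c m
  count-columns j c m = begin
    count j (concatMap column (range c m))
      ≡⟨ count-concatMap j column (range c m) ⟩
    ∑[ c′ ∈ range c m ] count j (column c′)
      ≡⟨ ∑-cong (range c m) (count-column j) ⟩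
    ∑[ c′ ∈ range c m ] ∑[ s ∈ S ] 𝟙 (label s ≡ᵇ j) * seenIn s c′
      ≡⟨ ∑-swap (range c m) S _ ⟩
    ∑[ s ∈ S ] ∑[ c′ ∈ range c m ] 𝟙 (label s ≡ᵇ j) * seenIn s c′
      ≡⟨ ∑-cong S (λ s → ∑-*ˡ (range c m) (𝟙 (label s ≡ᵇ j)) (seenIn s)) ⟩
    ∑[ s ∈ S ] 𝟙 (label s ≡ᵇ j) * seenInColumns s c m ∎
    where open ≡-Reasoning

  columns-suffix : ∀ c m → ∃[ n ] drop n (concatMap column (upTo (c + m))) ≡ concatMap column (range c m)
  columns-suffix c m = length (concatMap column (range 0 c)) , (begin
    drop n (concatMap column (upTo (c + m)))
      ≡⟨ cong (λ cs → drop n (concatMap column cs)) (trans (upTo≡range (c + m)) (range-++ 0 c m)) ⟩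
    drop n (concatMap column (range 0 c ++ range c m))
      ≡⟨ cong (drop n) (concatMap-++ column (range 0 c) (range c m)) ⟩
    drop n (concatMap column (range 0 c) ++ concatMap column (range c m))
      ≡⟨ drop-++ (concatMap column (range 0 c)) _ ⟩
    concatMap column (range c m) ∎)
    where
    open ≡-Reasoning
    n : ℕ
    n = length (concatMap column (range 0 c))

  module _ (k N : ℕ) (lat : LatticedAt k (concatMap column (upTo N))) where

    latticedAt-columns : ∀ c m → c + m ≡ N →
      ∑[ s ∈ S ] 𝟙 (label s ≡ᵇ suc k) * seenInColumns s c m ≤ ∑[ s ∈ S ] 𝟙 (label s ≡ᵇ k) * seenInColumns s c m
    latticedAt-columns c m refl with columns-suffix c m
    ... | n , suffix = begin
      ∑[ s ∈ S ] 𝟙 (label s ≡ᵇ suc k) * seenInColumns s c m ≡⟨ count-columns (suc k) c m ⟨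
      count (suc k) (concatMap column (range c m))          ≡⟨ cong (count (suc k)) suffix ⟨
      count (suc k) (drop n (concatMap column (upTo N)))    ≤⟨ lat n ⟩
      count k (drop n (concatMap column (upTo N)))          ≡⟨ cong (count k) suffix ⟩
      count k (concatMap column (range c m))                ≡⟨ count-columns k c m ⟩
      ∑[ s ∈ S ] 𝟙 (label s ≡ᵇ k) * seenInColumns s c m     ∎
      where open ≤-Reasoning

    module _ (a : ℕ)
      (seen : ∀ {s} → s ∈ S → 1 ≤ seenInColumns s 0 N)
      (seen-≤1 : ∀ {s} → s ∈ S → ∀ c m → seenInColumns s c m ≤ 1)
      (rowNo-< : ∀ {P Q} c m → P ∈ S → Q ∈ S → label P < label Q →
                 1 ≤ seenIn Q c → 1 ≤ seenInColumns P c m → rowNo P < rowNo Q)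
      where

      counted : LabelledStrip → ℕ
      counted s = 𝟙 (label s ≡ᵇ suc k) * 𝟙 (rowNo s <ᵇ suc a)

      -- a strip labelled k seen in a column ≥ c has a smaller row number than Q, hence one < a
      boundFrom : ∀ Q c m → Q ∈ S → 1 ≤ counted Q * seenIn Q c → ∀ s → s ∈ S →
                  𝟙 (label s ≡ᵇ k) * seenInColumns s c m ≤ 𝟙 (label s ≡ᵇ k) * 𝟙 (rowNo s <ᵇ a)
      boundFrom Q c m Q∈ seenQ s s∈
        with 𝟙*n-pos (label Q ≡ᵇ suc k) (subst (1 ≤_) (*-assoc (𝟙 (label Q ≡ᵇ suc k)) _ _) seenQ)
      ... | labelQ , seenQ′ with 𝟙*n-pos (rowNo Q <ᵇ suc a) seenQ′ | label s ≡ᵇ k in labelS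
      ... | rowNoQ , seenQc | false = z≤n
      ... | rowNoQ , seenQc | true = *-monoʳ-≤ 1 (≤𝟙 (rowNo s <ᵇ a) (seen-≤1 s∈ c m) (λ seenS →
              <⇒<ᵇ (≤-trans (rowNo-< c m s∈ Q∈ label-s<label-Q seenQc seenS) (s≤s⁻¹ (<ᵇ⇒< _ _ rowNoQ)))))
        where
        label-s<label-Q : label s < label Q
        label-s<label-Q = ≤-reflexive (trans (cong suc (≡ᵇ⇒≡ _ _ (subst T (sym labelS) _))) (sym (≡ᵇ⇒≡ _ _ labelQ)))

      scan : ∀ m c → c + m ≡ N → ∑[ s ∈ S ] counted s * seenInColumns s c m ≤ #labelled k rowNo< a
      scan zero c _ = subst (_≤ #labelled k rowNo< a) (sym (∑-zero S _ (λ s _ → *-zeroʳ (counted s)))) z≤n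
      scan (suc m) c c+m≡N with ∑[ s ∈ S ] counted s * seenIn s c in seenAtC
      ... | zero = begin
        ∑[ s ∈ S ] counted s * seenInColumns s c (suc m)
          ≡⟨ ∑-cong S (λ s → *-distribˡ-+ (counted s) (seenIn s c) _) ⟩
        ∑[ s ∈ S ] (counted s * seenIn s c + counted s * seenInColumns s (suc c) m)
          ≡⟨ ∑-distrib-+ S _ _ ⟩
        (∑[ s ∈ S ] counted s * seenIn s c) + (∑[ s ∈ S ] counted s * seenInColumns s (suc c) m)
          ≡⟨ cong (_+ (∑[ s ∈ S ] counted s * seenInColumns s (suc c) m)) seenAtC ⟩
        ∑[ s ∈ S ] counted s * seenInColumns s (suc c) m
          ≤⟨ scan m (suc c) (trans (sym (+-suc c m)) c+m≡N) ⟩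
        #labelled k rowNo< a ∎
        where open ≤-Reasoning
      ... | suc _ with ∑-pos⇒∃ S _ (subst (1 ≤_) (sym seenAtC) (s≤s z≤n))
      ...   | Q , Q∈ , seenQ = begin
        ∑[ s ∈ S ] counted s * seenInColumns s c (suc m)
          ≤⟨ ∑-mono-≤ S (λ s _ → *-monoˡ-≤ (seenInColumns s c (suc m))
                                             (*𝟙-≤ (𝟙 (label s ≡ᵇ suc k)) (rowNo s <ᵇ suc a))) ⟩
        ∑[ s ∈ S ] 𝟙 (label s ≡ᵇ suc k) * seenInColumns s c (suc m)
          ≤⟨ latticedAt-columns c (suc m) c+m≡N ⟩
        ∑[ s ∈ S ] 𝟙 (label s ≡ᵇ k) * seenInColumns s c (suc m)
          ≤⟨ ∑-mono-≤ S (boundFrom Q c (suc m) Q∈ seenQ) ⟩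
        #labelled k rowNo< a ∎
        where open ≤-Reasoning

      #labelled-suc-≤ : #labelled suc k rowNo< suc a ≤ #labelled k rowNo< a
      #labelled-suc-≤ = ≤-trans
        (∑-mono-≤ S (λ s s∈ → subst (_≤ counted s * seenInColumns s 0 N) (*-identityʳ (counted s))
                                     (*-monoʳ-≤ (counted s) (seen s∈))))
        (scan N 0 refl)

module FirstSeenCounts {r : ℕ} (ν : Partition) (pν : IsPartition ν) (S : List LabelledStrip)
  (valid : ∀ {s} → s ∈ S → IsStripIn r ν s)
  (ordered : ∀ {P Q} → P ∈ S → Q ∈ S → label P < label Q → outer P ⊆ₚ inner Q) where

  H : ℕ
  H = length ν

  open ColumnWord S H (λ s → firstSeenᵇ H (proj₂ s))

  module _ {s : LabelledStrip} (s∈ : s ∈ S) where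
    open IsStripIn (valid s∈)

    rows<H : ∀ x y → InSkew (inner s) (outer s) (x , y) → x < H
    rows<H x y b = !-pos⇒<length ν (<-≤-trans (proj₂ b) (outer⊆ν x))

    seenIn-pos : ∀ {c} → 1 ≤ seenIn s c → ∃[ a ] FirstSeen H (inner s) (outer s) a c
    seenIn-pos p with ∑-pos⇒∃ (upTo H) _ p
    ... | a , _ , fs = a , firstSeenᵇ⁻ H (inner s) (outer s) (𝟙-pos fs)

    seenInColumns-pos : ∀ {c m} → 1 ≤ seenInColumns s c m →
                        ∃[ c′ ] c ≤ c′ × ∃[ a ] FirstSeen H (inner s) (outer s) a c′
    seenInColumns-pos {c} {m} p with ∑-pos⇒∃ (range c m) (seenIn s) p
    ... | c′ , c′∈ , fs = c′ , proj₁ (∈-range⁻ c′∈) , seenIn-pos fs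

    unique : ∀ {a c a′ c′} → FirstSeen H (inner s) (outer s) a c → FirstSeen H (inner s) (outer s) a′ c′ →
             a ≡ a′ × c ≡ c′
    unique = firstSeen-unique (inner s) (outer s) inner-partition outer-partition H rows<H

    seen : 1 ≤ seenInColumns s 0 (ν ! 0)
    seen with borderStrip
    ... | _ , _ , ((_ , box₀) , _) , _ with firstSeen-exists (inner s) (outer s) inner-partition outer-partition H rows<H box₀
    ...   | a , fs = begin
      1                                     ≤⟨ T⇒𝟙-pos (firstSeenᵇ⁺ H (inner s) (outer s) fs) ⟩
      𝟙 (firstSeenᵇ H (proj₂ s) (a , c))   ≤⟨ ∈⇒≤∑ (upTo H) _ (∈-upTo⁺ (rows<H a c (FirstSeen.box fs))) ⟩
      seenIn s c                            ≤⟨ ∈⇒≤∑ (range 0 (ν ! 0)) (seenIn s) (∈-range⁺ z≤n c<ν₀) ⟩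
      seenInColumns s 0 (ν ! 0)             ∎
      where
      open ≤-Reasoning
      c : ℕ
      c = inner s ! a
      c<ν₀ : c < ν ! 0
      c<ν₀ = <-≤-trans (proj₂ (FirstSeen.box fs)) (≤-trans (outer⊆ν a) (partition-antitone ν pν z≤n))

    seen-≤1 : ∀ c m → seenInColumns s c m ≤ 1
    seen-≤1 c m = ∑-≤1 (seenIn s) (range-unique c m) column-≤1 sameColumn
      where
      column-≤1 : ∀ c′ → seenIn s c′ ≤ 1
      column-≤1 c′ = ∑-≤1 _ (upTo⁺ H) (λ a → 𝟙≤1 _) λ a a′ p p′ →
        proj₁ (unique (firstSeenᵇ⁻ H (inner s) (outer s) (𝟙-pos p)) (firstSeenᵇ⁻ H (inner s) (outer s) (𝟙-pos p′)))
      sameColumn : ∀ c′ c″ → 1 ≤ seenIn s c′ → 1 ≤ seenIn s c″ → c′ ≡ c″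
      sameColumn c′ c″ p p′ = proj₂ (unique (proj₂ (seenIn-pos p)) (proj₂ (seenIn-pos p′)))

  rowNo-< : ∀ {P Q} c m → P ∈ S → Q ∈ S → label P < label Q →
            1 ≤ seenIn Q c → 1 ≤ seenInColumns P c m → rowNo P < rowNo Q
  rowNo-< {P} {Q} c m P∈ Q∈ P<Q seenQ seenP with seenIn-pos Q∈ seenQ | seenInColumns-pos P∈ {c} {m} seenP
  ... | t , fsQ | c′ , c≤c′ , a , fsP =
    rowNumber-< (inner P) (outer P) (inner Q) (outer Q)
      inner-partition outer-partition (IsStripIn.inner-partition (valid Q∈))
      borderStrip (IsStripIn.borderStrip (valid Q∈))
      (ordered P∈ Q∈ P<Q)
      (FirstSeen.box fsQ)
      (λ x y b → ≤-trans c≤c′ (firstSeen-leftmost (inner P) (outer P) inner-partition outer-partition H (rows<H P∈) fsP x y b))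
    where open IsStripIn (valid P∈)

proposition6p5 : (r : ℕ) (ν τ : Partition) (α : List ℕ) (T : RibbonTableau r ν τ α) →
    Latticed (columnWord T) → Latticed (rowNumberWord T)
proposition6p5 r ν τ α (pτ , chain) lat k 1≤k =
  latticedAt-firstRows k (λ a → #labelled-suc-≤ k (ν ! 0) (lat k 1≤k) a seen seen-≤1 rowNo-<) (length ν)
  where
  S : List LabelledStrip
  S = labelledStrips 1 chain
  open RowWord S
  open ColumnWord S (length ν) (λ s → firstSeenᵇ (length ν) (proj₂ s))
  open FirstSeenCounts ν (ribbonChain-partition chain pτ) S
    (labelledStrips-isStripIn chain 1 pτ) (labelledStrips-ordered chain 1)
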